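{- In the setting below, if $|\tilde S|=k$, then $f(\tilde S)\ge k\alpha$.
   Context: Setting (cardinality constraint): $N$ finite ground set, $f:2^N\to\mathbb{R}_{\ge0}$ nonnegative submodular, $f_A(e)=f(A\cup\{e\})-f(A)$, $k$ a positive integer, $\alpha\ge0$, $K$ a positive buffer limit. Elements of $N$ arrive in a stream. Algorithm Randomized-Streaming-Greedy$(\alpha,\infty)$: $B=\emptyset$, $S=\emptyset$; for each arriving $e$: if $|S|<k$ and $f_S(e)>\alpha$ then $B\leftarrow B\cup\{e\}$; if $|B|=K$ then pick $e'$ uniformly at random from $B$, set $B\leftarrow B\setminus\{e'\}$, $S\leftarrow S\cup\{e'\}$, and remove from $B$ every $b$ with $f_S(b)\le\alpha$. After the stream, an offline algorithm is run on the final $B$ and the better of the two solutions is output. $\tilde S$ denotes the final value of $S$.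
   Formalization: The function f takes nonnegative rational values instead of values in $\mathbb{R}_{\ge0}$, and the threshold α is rational. -}

module Defs where

open import Data.Nat using (ℕ; _<_) renaming (_<?_ to _<?ℕ_)
open import Data.Bool using (Bool; true; false; _∧_; if_then_else_)
open import Data.Fin using (Fin)
open import Data.Fin.Subset using (Subset; Side; inside; outside; ⁅_⁆; _∪_; _∩_; _∈_; ∣_∣) renaming (_-_ to _∖_)
open import Data.Vec using (tabulate; lookup)
open import Data.List using (List; []; _∷_)
open import Data.Rational using (ℚ; 0ℚ; _≤_; _+_; _-_)
open import Data.Rational.Properties using (_<?_)
open import Relation.Nullary using (does; ¬_)
open import Relation.Nullary.Decidable using (⌊_⌋)
open import Relation.Binary.PropositionalEquality using (_≡_)

SetFun : ℕ → Set
SetFun n = Subset n → ℚ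

NonNeg : ∀ {n} → SetFun n → Set
NonNeg f = ∀ A → 0ℚ ≤ f A

Submodular : ∀ {n} → SetFun n → Set
Submodular f = ∀ A B → f (A ∪ B) + f (A ∩ B) ≤ f A + f B

marg : ∀ {n} → SetFun n → Subset n → Fin n → ℚ
marg f A e = f (A ∪ ⁅ e ⁆) - f A

isInside : Side → Bool
isInside inside  = true
isInside outside = false

keepAbove : ∀ {n} → SetFun n → ℚ → Subset n → Subset n → Subset n
keepAbove f α S B =
  tabulate (λ i → if isInside (lookup B i) ∧ does (α <? marg f S i) then inside else outside)

record State (n : ℕ) : Set where
  constructor ⟨_,_⟩
  field
    buf : Subset n
    sol : Subset n

module Algorithm {n : ℕ} (f : SetFun n) (k : ℕ) (α : ℚ) (K : ℕ) where

  insertStep : Subset n → Subset n → Fin n → Subset n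
  insertStep B S e =
    if ⌊ ∣ S ∣ <?ℕ k ⌋ ∧ does (α <? marg f S e) then B ∪ ⁅ e ⁆ else B

  -- One step of processing an arriving element e.  The uniformly random
  -- choice of e' ∈ B is modelled nondeterministically: every possible
  -- choice gives a possible transition.
  data Step (e : Fin n) : State n → State n → Set where
    notFull : ∀ {B S} → ¬ (∣ insertStep B S e ∣ ≡ K) →
              Step e ⟨ B , S ⟩ ⟨ insertStep B S e , S ⟩
    full    : ∀ {B S} e' → ∣ insertStep B S e ∣ ≡ K → e' ∈ insertStep B S e →
              Step e ⟨ B , S ⟩
                ⟨ keepAbove f α (S ∪ ⁅ e' ⁆) (insertStep B S e ∖ e') , S ∪ ⁅ e' ⁆ ⟩

  data Run : List (Fin n) → State n → State n → Set where
    done : ∀ {σ} → Run [] σ σ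
    step : ∀ {e es σ σ' σ''} → Step e σ σ' → Run es σ' σ'' → Run (e ∷ es) σ σ''

-- Throughout the run, every buffered element b satisfies f_S(b) > α for the current
-- solution S, and f(S) ≥ |S| α.  An element enters the buffer only after the test
-- f_S(e) > α, and after each selection the buffer is pruned against the enlarged
-- solution.  Hence the selected element e' raises f by f_S(e') > α while |S| grows
-- by at most one.
module Submission where

open import Defs
open import Data.Nat as ℕ using (ℕ; suc; _≥_; z≤n; s≤s)
import Data.Nat.Properties as ℕ
open import Data.Nat.Coprimality using (1-coprimeTo) renaming (sym to coprime-sym)
open import Data.Integer as ℤ using (+_)
import Data.Integer.Properties as ℤ
open import Data.Fin using (Fin)
open import Data.Fin.Subset using (Subset; ⊥; ∣_∣; inside; outside; _∪_; ⁅_⁆; _∈_) renaming (_-_ to _∖_)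
open import Data.Fin.Subset.Properties using (∉⊥; ∣⊥∣≡0; ∣⁅x⁆∣≡1; x∈p∪q⁻; x∈⁅y⁆⇒x≡y)
open import Data.List using (List; allFin)
open import Data.List.Relation.Binary.Permutation.Propositional using (_↭_)
open import Data.Rational using (ℚ; mkℚ; 0ℚ; 1ℚ; _≤_; _<_; _+_; _-_; _*_; _/_; -_; *≤*; NonNegative; nonNegative)
import Data.Rational.Properties as ℚ
open import Data.Bool using (Bool; true; false; _∧_; if_then_else_)
open import Data.Vec using (_∷_; []; lookup)
open import Data.Vec.Properties using (lookup∘tabulate; []=⇒lookup)
open import Data.Empty using (⊥-elim)
open import Data.Sum using (_⊎_; inj₁; inj₂; map₂)
open import Data.Product using (_×_; _,_)
open import Relation.Nullary using (Dec; yes; no; does)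
open import Relation.Nullary.Decidable using (⌊_⌋)
open import Relation.Binary.PropositionalEquality using (_≡_; refl; sym; trans; cong; cong₂; subst)
open import Algebra.Properties.AbelianGroup ℚ.+-0-abelianGroup using (xyx⁻¹≈y)

∣p∪q∣≤∣p∣+∣q∣ : ∀ {n} (p q : Subset n) → ∣ p ∪ q ∣ ℕ.≤ ∣ p ∣ ℕ.+ ∣ q ∣
∣p∪q∣≤∣p∣+∣q∣ []            []            = z≤n
∣p∪q∣≤∣p∣+∣q∣ (inside  ∷ p) (inside  ∷ q) =
  s≤s (ℕ.≤-trans (∣p∪q∣≤∣p∣+∣q∣ p q) (ℕ.+-monoʳ-≤ ∣ p ∣ (ℕ.n≤1+n ∣ q ∣)))
∣p∪q∣≤∣p∣+∣q∣ (inside  ∷ p) (outside ∷ q) = s≤s (∣p∪q∣≤∣p∣+∣q∣ p q)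
∣p∪q∣≤∣p∣+∣q∣ (outside ∷ p) (inside  ∷ q) =
  subst (suc ∣ p ∪ q ∣ ℕ.≤_) (sym (ℕ.+-suc ∣ p ∣ ∣ q ∣)) (s≤s (∣p∪q∣≤∣p∣+∣q∣ p q))
∣p∪q∣≤∣p∣+∣q∣ (outside ∷ p) (outside ∷ q) = ∣p∪q∣≤∣p∣+∣q∣ p q

∣p∪⁅x⁆∣≤∣p∣+1 : ∀ {n} (p : Subset n) (x : Fin n) → ∣ p ∪ ⁅ x ⁆ ∣ ℕ.≤ ∣ p ∣ ℕ.+ 1
∣p∪⁅x⁆∣≤∣p∣+1 p x = subst (∣ p ∪ ⁅ x ⁆ ∣ ℕ.≤_) (cong (∣ p ∣ ℕ.+_) (∣⁅x⁆∣≡1 x)) (∣p∪q∣≤∣p∣+∣q∣ p ⁅ x ⁆)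

pos/1≡mkℚ : ∀ m → + m / 1 ≡ mkℚ (+ m) 0 (coprime-sym (1-coprimeTo m))
pos/1≡mkℚ m = ℚ.normalize-coprime (coprime-sym (1-coprimeTo m))

pos/1-+ : ∀ m n → + (m ℕ.+ n) / 1 ≡ + m / 1 + + n / 1
pos/1-+ m n rewrite pos/1≡mkℚ m | pos/1≡mkℚ n =
  cong (_/ 1) (trans (ℤ.pos-+ m n) (sym (cong₂ ℤ._+_ (ℤ.*-identityʳ (+ m)) (ℤ.*-identityʳ (+ n)))))

pos/1-mono-≤ : ∀ {m n} → m ℕ.≤ n → + m / 1 ≤ + n / 1
pos/1-mono-≤ {m} {n} m≤n rewrite pos/1≡mkℚ m | pos/1≡mkℚ n =
  *≤* (ℤ.*-monoʳ-≤-nonNeg (+ 1) (ℤ.+≤+ m≤n))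

c*α≤x⇒[c+1]*α≤y : ∀ {c x y α} → c * α ≤ x → α ≤ y - x → (c + 1ℚ) * α ≤ y
c*α≤x⇒[c+1]*α≤y {c} {x} {y} {α} cα≤x α≤y-x = begin
  (c + 1ℚ) * α        ≡⟨ ℚ.*-distribʳ-+ α c 1ℚ ⟩
  c * α + 1ℚ * α      ≡⟨ cong (λ z → c * α + z) (ℚ.*-identityˡ α) ⟩
  c * α + α           ≤⟨ ℚ.+-mono-≤ cα≤x α≤y-x ⟩
  x + (y - x)         ≡⟨ sym (ℚ.+-assoc x y (- x)) ⟩
  x + y - x           ≡⟨ xyx⁻¹≈y x y ⟩
  y                   ∎
  where open ℚ.≤-Reasoning

m*α≤x⇒m′*α≤y : ∀ {m m′ x y α} → 0ℚ ≤ α → m′ ℕ.≤ m ℕ.+ 1 →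
                (+ m / 1) * α ≤ x → α < y - x → (+ m′ / 1) * α ≤ y
m*α≤x⇒m′*α≤y {m} {m′} {x} {y} {α} 0≤α m′≤m+1 mα≤x α<y-x = begin
  (+ m′ / 1) * α          ≤⟨ ℚ.*-monoʳ-≤-nonNeg α (pos/1-mono-≤ m′≤m+1) ⟩
  (+ (m ℕ.+ 1) / 1) * α   ≡⟨ cong (_* α) (pos/1-+ m 1) ⟩
  (+ m / 1 + 1ℚ) * α      ≤⟨ c*α≤x⇒[c+1]*α≤y {c = + m / 1} mα≤x (ℚ.<⇒≤ α<y-x) ⟩
  y                       ∎
  where
  open ℚ.≤-Reasoning
  instance
    α-nonNeg : NonNegative α
    α-nonNeg = nonNegative 0≤α

∈-if-∪⁅⁆⁻ : ∀ {n} {P : Set} {B : Subset n} {e x : Fin n} (c : Bool) (d : Dec P) →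
            x ∈ (if c ∧ does d then B ∪ ⁅ e ⁆ else B) → x ∈ B ⊎ (x ≡ e × P)
∈-if-∪⁅⁆⁻               false d       x∈B   = inj₁ x∈B
∈-if-∪⁅⁆⁻               true  (no _)  x∈B   = inj₁ x∈B
∈-if-∪⁅⁆⁻ {B = B} {e} true  (yes p) x∈B∪e =
  map₂ (λ x∈⁅e⁆ → x∈⁅y⁆⇒x≡y e x∈⁅e⁆ , p) (x∈p∪q⁻ B ⁅ e ⁆ x∈B∪e)

if-inside⁻ : ∀ {P : Set} (c : Bool) (d : Dec P) → (if c ∧ does d then inside else outside) ≡ inside → P
if-inside⁻ c     (yes p) _  = p
if-inside⁻ true  (no _)  ()
if-inside⁻ false (no _)  ()

∈-keepAbove⁻ : ∀ {n} (f : SetFun n) α S B {b} → b ∈ keepAbove f α S B → α < marg f S b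
∈-keepAbove⁻ f α S B {b} b∈ =
  if-inside⁻ (isInside (lookup B b)) (α ℚ.<? marg f S b)
    (trans (sym (lookup∘tabulate _ b)) ([]=⇒lookup b∈))

module _ {n} (f : SetFun n) (k : ℕ) (α : ℚ) (K : ℕ) where
  open Algorithm f k α K

  ∈-insertStep⁻ : ∀ B S e {b} → b ∈ insertStep B S e → b ∈ B ⊎ (b ≡ e × α < marg f S e)
  ∈-insertStep⁻ B S e = ∈-if-∪⁅⁆⁻ ⌊ ∣ S ∣ ℕ.<? k ⌋ (α ℚ.<? marg f S e)

  AboveThreshold : Subset n → Subset n → Set
  AboveThreshold B S = ∀ {b} → b ∈ B → α < marg f S b

  insertStep-above : ∀ {B S} e → AboveThreshold B S → AboveThreshold (insertStep B S e) S
  insertStep-above {B} {S} e B-above b∈ with ∈-insertStep⁻ B S e b∈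
  ... | inj₁ b∈B          = B-above b∈B
  ... | inj₂ (refl , α<e) = α<e

  record Invariant (σ : State n) : Set where
    field
      buffer-above : AboveThreshold (State.buf σ) (State.sol σ)
      value-bound  : (+ ∣ State.sol σ ∣ / 1) * α ≤ f (State.sol σ)

  initial : NonNeg f → Invariant ⟨ ⊥ , ⊥ ⟩
  initial f≥0 = record
    { buffer-above = λ b∈⊥ → ⊥-elim (∉⊥ b∈⊥)
    ; value-bound  = subst (_≤ f ⊥) (sym ∣⊥∣*α≡0) (f≥0 ⊥)
    }
    where
    ∣⊥∣*α≡0 : (+ ∣ ⊥ {n = n} ∣ / 1) * α ≡ 0ℚ
    ∣⊥∣*α≡0 = trans (cong (λ m → (+ m / 1) * α) (∣⊥∣≡0 n)) (ℚ.*-zeroˡ α)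

  step-preserves : 0ℚ ≤ α → ∀ {e σ σ′} → Step e σ σ′ → Invariant σ → Invariant σ′
  step-preserves _ {e} (notFull _) inv = record
    { buffer-above = insertStep-above e buffer-above
    ; value-bound  = value-bound
    }
    where open Invariant inv
  step-preserves 0≤α {e} (full {B} {S} e′ _ e′∈) inv = record
    { buffer-above = ∈-keepAbove⁻ f α (S ∪ ⁅ e′ ⁆) (insertStep B S e ∖ e′)
    ; value-bound  = m*α≤x⇒m′*α≤y 0≤α (∣p∪⁅x⁆∣≤∣p∣+1 S e′) value-bound (insertStep-above e buffer-above e′∈)
    }
    where open Invariant inv

  run-preserves : 0ℚ ≤ α → ∀ {es σ σ′} → Run es σ σ′ → Invariant σ → Invariant σ′
  run-preserves _   done         inv = inv
  run-preserves 0≤α (step s run) inv = run-preserves 0≤α run (step-preserves 0≤α s inv)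

mainTheorem15 : (n : ℕ) (f : SetFun n) → NonNeg f → Submodular f →
    (k : ℕ) → k ≥ 1 → (α : ℚ) → 0ℚ ≤ α → (K : ℕ) → K ≥ 1 →
    (stream : List (Fin n)) → stream ↭ allFin n →
    (B̃ S̃ : Subset n) → Algorithm.Run f k α K stream ⟨ ⊥ , ⊥ ⟩ ⟨ B̃ , S̃ ⟩ →
    ∣ S̃ ∣ ≡ k → (+ k / 1) * α ≤ f S̃
mainTheorem15 _ f f≥0 _ k _ α 0≤α K _ _ _ _ _ run refl =
  Invariant.value-bound (run-preserves f k α K 0≤α run (initial f k α K f≥0))
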